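{- Let $v_1=v_1(z)$ be the unique root of $z u^3+(z^2-1)u^2-z^3u+z^2=0$ that is a formal Laurent series in $z$ of the form $v_1=\frac1z-z-z^5-2z^7-\cdots$, and put $g_0=\frac{zv_1}{v_1^2-z^2}$ and $h_0=\frac{z^2}{v_1^2-z^2}$. Consider partial Dyck paths (paths of up-steps and down-steps starting at the origin and never going below the $x$-axis, not necessarily ending on it), counted by length via the variable $z$. For $j\ge0$ define: - $f_j(z)$: the generating function of such paths ending at height $j$ that are either empty (only for $j=0$) or end with an up-step, and all of whose descents have odd length; - $g_j(z)$: the generating function of such paths ending at height $j$ with a down-step, all of whose descents (including the final, current one) have odd length; - $h_j(z)$: the generating function of such paths ending at height $j$ with a down-step, where the final (current) descent has even length and all other descents have odd length. Then $f_0=1$, $f_j=v_1^{ -j}$ for $j\ge1$, and for all $j\ge0$ $$g_j=\frac{z(1+h_0)}{v_1^{j+1}},\qquad h_j=\frac{z\,g_0}{v_1^{j+1}}.$$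
   Context: A descent is a maximal run of consecutive down-steps; its length is the number of down-steps in it. The coefficient of $z^n$ in each generating function is the number of such paths of length $n$. -}

module Defs where

open import Data.Bool using (Bool; true; false; _∧_; if_then_else_)
open import Data.Nat as ℕ using (ℕ; zero; suc; _∸_)
open import Data.Integer as ℤ using (ℤ; +_; -_; _+_; _*_; _-_)
open import Data.List using (List; []; _∷_; map; _++_)
open import Data.Maybe using (Maybe; just; nothing)
open import Data.Product using (_×_; _,_)

Series : Set
Series = ℕ → ℤ

sumBelow : (ℕ → ℤ) → ℕ → ℤ
sumBelow f zero    = + 0
sumBelow f (suc n) = sumBelow f n + f n

_⊕_ : Series → Series → Series
(a ⊕ b) n = a n + b n

_⊖_ : Series → Series → Series
(a ⊖ b) n = a n - b n

_⊗_ : Series → Series → Series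
(a ⊗ b) n = sumBelow (λ k → a k * b (n ∸ k)) (suc n)

infixl 6 _⊕_ _⊖_
infixl 7 _⊗_

one : Series
one zero    = + 1
one (suc n) = + 0

Z : Series
Z (suc zero) = + 1
Z _          = + 0

_^ˢ_ : Series → ℕ → Series
a ^ˢ zero  = one
a ^ˢ suc k = a ⊗ (a ^ˢ k)

infixr 8 _^ˢ_

-- Multiplicative inverse of a series whose constant term is a unit (±1):
-- b₀ = a₀ (= a₀⁻¹), b_n = - a₀ · Σ_{k=1}^{n} a_k b_{n-k}.
-- invRev a n = [b_n , b_{n-1} , … , b_0].
invRev : Series → ℕ → List ℤ
invRev a zero    = a 0 ∷ []
invRev a (suc n) = (- (a 0 * dot 1 prev)) ∷ prev
  where
  prev = invRev a n
  dot : ℕ → List ℤ → ℤ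
  dot k []       = + 0
  dot k (x ∷ xs) = a k * x + dot (suc k) xs

inv : Series → Series
inv a n with invRev a n
... | []    = + 0
... | x ∷ _ = x

-- Partial Dyck paths.  A path is a list of steps: true = up, false = down.

endHeightFrom : ℕ → List Bool → Maybe ℕ
endHeightFrom h       []           = just h
endHeightFrom h       (true ∷ p)   = endHeightFrom (suc h) p
endHeightFrom zero    (false ∷ p)  = nothing
endHeightFrom (suc h) (false ∷ p)  = endHeightFrom h p

endsAt : ℕ → List Bool → Bool
endsAt j p with endHeightFrom 0 p
... | nothing = false
... | just h  = h ℕ.≡ᵇ j

-- lengths of the descents (maximal runs of down-steps), in order;
-- the argument k is the length of the current (unfinished) run.
descentsAux : ℕ → List Bool → List ℕ
descentsAux zero    []          = []
descentsAux (suc k) []          = suc k ∷ []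
descentsAux zero    (true ∷ p)  = descentsAux zero p
descentsAux (suc k) (true ∷ p)  = suc k ∷ descentsAux zero p
descentsAux k       (false ∷ p) = descentsAux (suc k) p

descents : List Bool → List ℕ
descents = descentsAux zero

odd : ℕ → Bool
odd zero          = false
odd (suc zero)    = true
odd (suc (suc n)) = odd n

even : ℕ → Bool
even n = if odd n then false else true

allOdd : List ℕ → Bool
allOdd []       = true
allOdd (x ∷ xs) = odd x ∧ allOdd xs

lastStep : List Bool → Maybe Bool
lastStep []           = nothing
lastStep (s ∷ [])     = just s
lastStep (s ∷ t ∷ p)  = lastStep (t ∷ p)

isEmpty : List Bool → Bool
isEmpty [] = true
isEmpty _  = false

endsUp : List Bool → Bool
endsUp p with lastStep p
... | just true = true
... | _         = false

endsDown : List Bool → Bool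
endsDown p with lastStep p
... | just false = true
... | _          = false

lastEvenOthersOdd : List ℕ → Bool
lastEvenOthersOdd []           = false
lastEvenOthersOdd (x ∷ [])     = even x
lastEvenOthersOdd (x ∷ y ∷ xs) = odd x ∧ lastEvenOthersOdd (y ∷ xs)

isF : ℕ → List Bool → Bool
isF j p = endsAt j p ∧ ((isEmpty p ∧ (j ℕ.≡ᵇ 0)) Data.Bool.∨ endsUp p) ∧ allOdd (descents p)

isG : ℕ → List Bool → Bool
isG j p = endsAt j p ∧ endsDown p ∧ allOdd (descents p)

isH : ℕ → List Bool → Bool
isH j p = endsAt j p ∧ endsDown p ∧ lastEvenOthersOdd (descents p)

allPaths : ℕ → List (List Bool)
allPaths zero    = [] ∷ []
allPaths (suc n) = map (true ∷_) (allPaths n) ++ map (false ∷_) (allPaths n)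

countᵇ : {A : Set} → (A → Bool) → List A → ℕ
countᵇ P []       = 0
countᵇ P (x ∷ xs) = if P x then suc (countᵇ P xs) else countᵇ P xs

gf : (List Bool → Bool) → Series
gf P n = + countᵇ P (allPaths n)

f g h : ℕ → Series
f j = gf (isF j)
g j = gf (isG j)
h j = gf (isH j)

-- The Laurent series v₁ is represented by w = z·v₁ (a power series with
-- constant term 1).  The equation z u³ + (z²-1)u² - z³u + z² = 0 at u = v₁ = w/z,
-- multiplied by z³:  z w³ + (z²-1) z w² - z⁵ w + z⁵ = 0.
IsRootW : Series → Set
IsRootW w = ∀ n →
  (Z ⊗ w ^ˢ 3 ⊕ (Z ^ˢ 2 ⊖ one) ⊗ Z ⊗ w ^ˢ 2 ⊖ Z ^ˢ 5 ⊗ w ⊕ Z ^ˢ 5) n Relation.Binary.PropositionalEquality.≡ + 0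
  where import Relation.Binary.PropositionalEquality

-- v₁⁻ᵏ = z^k · w⁻ᵏ
vInvPow : Series → ℕ → Series
vInvPow w k = Z ^ˢ k ⊗ inv w ^ˢ k

-- g₀ = z v₁/(v₁² - z²) = z² w /(w² - z⁴),  h₀ = z²/(v₁² - z²) = z⁴/(w² - z⁴)
G0 H0 : Series → Series
G0 w = Z ^ˢ 2 ⊗ w ⊗ inv (w ^ˢ 2 ⊖ Z ^ˢ 4)
H0 w = Z ^ˢ 4 ⊗ inv (w ^ˢ 2 ⊖ Z ^ˢ 4)

{-# OPTIONS --safe #-}
-- Removing the last step of a path shows that f, g, h satisfy
--   f₀ = 1,   f_{j+1} = z (f_j + g_j),   g_j = z (f_{j+1} + h_{j+1}),   h_j = z g_{j+1},
-- and these recurrences determine every coefficient by induction on the length. So it suffices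
-- that the claimed series satisfy them too. They are geometric in j with ratio v₁⁻¹, which reduces
-- the recurrences to  v₁⁻¹ = z (1 + g₀),  g₀ = z (1 + h₀) v₁⁻¹  and  h₀ = z g₀ v₁⁻¹. The last two
-- are immediate from the definitions of g₀ and h₀; the first is the equation of v₁ divided by
-- v₁ (v₁² − z²). Everything is computed with w = z v₁, whose constant term 1 makes w and w² − z⁴
-- invertible power series.
module Submission where

open import Defs
open import Data.Nat using (ℕ; suc; _≤_)
open import Data.Integer using (ℤ; +_)
open import Data.Product using (_×_)
open import Relation.Binary.PropositionalEquality using (_≡_)

open import Data.Nat using (zero)
open import Data.Product using (_,_)
open import Relation.Binary.PropositionalEquality using (refl; sym; trans; cong; cong₂; _≗_; module ≡-Reasoning)

module FormalPowerSeries where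

  open import Data.Nat as ℕ using (_∸_)
  import Data.Nat.Properties as ℕₚ
  open import Data.Integer using (-[1+_]; _+_; _*_; -_)
  import Data.Integer.Properties as ℤ
  open import Data.Integer.Tactic.RingSolver using (solve-∀)
  open import Data.Maybe using (Maybe; just; nothing)
  open import Data.List using (List; []; _∷_)
  open import Relation.Nullary using (yes; no)
  open import Algebra.Bundles using (CommutativeRing)
  open import Level using (0ℓ)
  import Algebra.Solver.Ring.AlmostCommutativeRing as ACR
  import Algebra.Solver.Ring as RingSolver

  tail : Series → Series
  tail a n = a (suc n)

  zeroˢ : Series
  zeroˢ _ = + 0

  neg : Series → Series
  neg a n = - a n

  sumBelow-suc : ∀ (t : ℕ → ℤ) n → sumBelow t (suc n) ≡ t 0 + sumBelow (λ k → t (suc k)) n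
  sumBelow-suc t zero    = trans (ℤ.+-identityˡ (t 0)) (sym (ℤ.+-identityʳ (t 0)))
  sumBelow-suc t (suc n) = trans (cong (λ s → s + t (suc n)) (sumBelow-suc t n)) (ℤ.+-assoc (t 0) _ _)

  ⊗-zeroth : ∀ a b → (a ⊗ b) 0 ≡ a 0 * b 0
  ⊗-zeroth a b = ℤ.+-identityˡ (a 0 * b 0)

  ⊗-suc : ∀ a b n → (a ⊗ b) (suc n) ≡ a 0 * b (suc n) + (tail a ⊗ b) n
  ⊗-suc a b n = sumBelow-suc (λ k → a k * b (suc n ∸ k)) (suc n)

  ⊗-sucʳ : ∀ a b n → (a ⊗ b) (suc n) ≡ (a ⊗ tail b) n + a (suc n) * b 0
  ⊗-sucʳ a b zero = begin
    (a ⊗ b) 1                     ≡⟨ ⊗-suc a b 0 ⟩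
    a 0 * b 1 + (tail a ⊗ b) 0    ≡⟨ cong (λ t → a 0 * b 1 + t) (⊗-zeroth (tail a) b) ⟩
    a 0 * b 1 + a 1 * b 0         ≡⟨ cong (λ t → t + a 1 * b 0) (⊗-zeroth a (tail b)) ⟨
    (a ⊗ tail b) 0 + a 1 * b 0    ∎
    where open ≡-Reasoning
  ⊗-sucʳ a b (suc n) = begin
    (a ⊗ b) (suc (suc n))
      ≡⟨ ⊗-suc a b (suc n) ⟩
    a 0 * b (suc (suc n)) + (tail a ⊗ b) (suc n)
      ≡⟨ cong (λ t → a 0 * b (suc (suc n)) + t) (⊗-sucʳ (tail a) b n) ⟩
    a 0 * b (suc (suc n)) + ((tail a ⊗ tail b) n + a (suc (suc n)) * b 0)
      ≡⟨ ℤ.+-assoc (a 0 * b (suc (suc n))) _ _ ⟨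
    a 0 * b (suc (suc n)) + (tail a ⊗ tail b) n + a (suc (suc n)) * b 0
      ≡⟨ cong (λ t → t + a (suc (suc n)) * b 0) (⊗-suc a (tail b) n) ⟨
    (a ⊗ tail b) (suc n) + a (suc (suc n)) * b 0
      ∎
    where open ≡-Reasoning

  ⊗-cong : ∀ {a a′ b b′} → a ≗ a′ → b ≗ b′ → a ⊗ b ≗ a′ ⊗ b′
  ⊗-cong {a} {a′} {b} {b′} a≗a′ b≗b′ zero = begin
    (a ⊗ b) 0    ≡⟨ ⊗-zeroth a b ⟩
    a 0 * b 0    ≡⟨ cong₂ _*_ (a≗a′ 0) (b≗b′ 0) ⟩
    a′ 0 * b′ 0  ≡⟨ ⊗-zeroth a′ b′ ⟨
    (a′ ⊗ b′) 0  ∎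
    where open ≡-Reasoning
  ⊗-cong {a} {a′} {b} {b′} a≗a′ b≗b′ (suc n) = begin
    (a ⊗ b) (suc n)                          ≡⟨ ⊗-suc a b n ⟩
    a 0 * b (suc n) + (tail a ⊗ b) n         ≡⟨ cong₂ _+_ (cong₂ _*_ (a≗a′ 0) (b≗b′ (suc n)))
                                                          (⊗-cong (λ k → a≗a′ (suc k)) b≗b′ n) ⟩
    a′ 0 * b′ (suc n) + (tail a′ ⊗ b′) n     ≡⟨ ⊗-suc a′ b′ n ⟨
    (a′ ⊗ b′) (suc n)                        ∎
    where open ≡-Reasoning

  ⊗-zeroˡ : ∀ b → zeroˢ ⊗ b ≗ zeroˢ
  ⊗-zeroˡ b zero    = ⊗-zeroth zeroˢ b
  ⊗-zeroˡ b (suc n) = trans (⊗-suc zeroˢ b n) (trans (ℤ.+-identityˡ _) (⊗-zeroˡ b n))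

  ⊗-identityˡ : ∀ b → one ⊗ b ≗ b
  ⊗-identityˡ b zero    = trans (⊗-zeroth one b) (ℤ.*-identityˡ (b 0))
  ⊗-identityˡ b (suc n) = begin
    (one ⊗ b) (suc n)                    ≡⟨ ⊗-suc one b n ⟩
    + 1 * b (suc n) + (zeroˢ ⊗ b) n      ≡⟨ cong₂ _+_ (ℤ.*-identityˡ (b (suc n))) (⊗-zeroˡ b n) ⟩
    b (suc n) + + 0                      ≡⟨ ℤ.+-identityʳ (b (suc n)) ⟩
    b (suc n)                            ∎
    where open ≡-Reasoning

  ⊗-comm : ∀ a b → a ⊗ b ≗ b ⊗ a
  ⊗-comm a b zero    = trans (⊗-zeroth a b) (trans (ℤ.*-comm (a 0) (b 0)) (sym (⊗-zeroth b a)))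
  ⊗-comm a b (suc n) = begin
    (a ⊗ b) (suc n)                      ≡⟨ ⊗-suc a b n ⟩
    a 0 * b (suc n) + (tail a ⊗ b) n     ≡⟨ cong (λ t → a 0 * b (suc n) + t) (⊗-comm (tail a) b n) ⟩
    a 0 * b (suc n) + (b ⊗ tail a) n     ≡⟨ ℤ.+-comm (a 0 * b (suc n)) _ ⟩
    (b ⊗ tail a) n + a 0 * b (suc n)     ≡⟨ cong (λ t → (b ⊗ tail a) n + t) (ℤ.*-comm (a 0) (b (suc n))) ⟩
    (b ⊗ tail a) n + b (suc n) * a 0     ≡⟨ ⊗-sucʳ b a n ⟨
    (b ⊗ a) (suc n)                      ∎
    where open ≡-Reasoning

  ⊗-distribʳ : ∀ a b c → (a ⊕ b) ⊗ c ≗ a ⊗ c ⊕ b ⊗ c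
  ⊗-distribʳ a b c zero = begin
    ((a ⊕ b) ⊗ c) 0               ≡⟨ ⊗-zeroth (a ⊕ b) c ⟩
    (a 0 + b 0) * c 0             ≡⟨ ℤ.*-distribʳ-+ (c 0) (a 0) (b 0) ⟩
    a 0 * c 0 + b 0 * c 0         ≡⟨ cong₂ _+_ (⊗-zeroth a c) (⊗-zeroth b c) ⟨
    (a ⊗ c) 0 + (b ⊗ c) 0         ∎
    where open ≡-Reasoning
  ⊗-distribʳ a b c (suc n) = begin
    ((a ⊕ b) ⊗ c) (suc n)
      ≡⟨ ⊗-suc (a ⊕ b) c n ⟩
    (a 0 + b 0) * c (suc n) + (tail (a ⊕ b) ⊗ c) n
      ≡⟨ cong (λ t → (a 0 + b 0) * c (suc n) + t) (⊗-distribʳ (tail a) (tail b) c n) ⟩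
    (a 0 + b 0) * c (suc n) + ((tail a ⊗ c) n + (tail b ⊗ c) n)
      ≡⟨ interchange (a 0) (b 0) (c (suc n)) _ _ ⟩
    (a 0 * c (suc n) + (tail a ⊗ c) n) + (b 0 * c (suc n) + (tail b ⊗ c) n)
      ≡⟨ cong₂ _+_ (⊗-suc a c n) (⊗-suc b c n) ⟨
    (a ⊗ c) (suc n) + (b ⊗ c) (suc n)
      ∎
    where
    open ≡-Reasoning
    interchange : ∀ x y z u v → (x + y) * z + (u + v) ≡ (x * z + u) + (y * z + v)
    interchange = solve-∀

  scale : ℤ → Series → Series
  scale k a n = k * a n

  scale-⊗ : ∀ k a b → scale k a ⊗ b ≗ scale k (a ⊗ b)
  scale-⊗ k a b zero = begin
    (scale k a ⊗ b) 0    ≡⟨ ⊗-zeroth (scale k a) b ⟩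
    k * a 0 * b 0        ≡⟨ ℤ.*-assoc k (a 0) (b 0) ⟩
    k * (a 0 * b 0)      ≡⟨ cong (k *_) (⊗-zeroth a b) ⟨
    k * (a ⊗ b) 0        ∎
    where open ≡-Reasoning
  scale-⊗ k a b (suc n) = begin
    (scale k a ⊗ b) (suc n)                         ≡⟨ ⊗-suc (scale k a) b n ⟩
    k * a 0 * b (suc n) + (scale k (tail a) ⊗ b) n  ≡⟨ cong (λ t → k * a 0 * b (suc n) + t) (scale-⊗ k (tail a) b n) ⟩
    k * a 0 * b (suc n) + k * (tail a ⊗ b) n        ≡⟨ factor k (a 0) (b (suc n)) _ ⟩
    k * (a 0 * b (suc n) + (tail a ⊗ b) n)          ≡⟨ cong (k *_) (⊗-suc a b n) ⟨
    k * (a ⊗ b) (suc n)                             ∎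
    where
    open ≡-Reasoning
    factor : ∀ x y z u → x * y * z + x * u ≡ x * (y * z + u)
    factor = solve-∀

  ⊗-assoc : ∀ a b c → (a ⊗ b) ⊗ c ≗ a ⊗ (b ⊗ c)
  ⊗-assoc a b c zero = begin
    ((a ⊗ b) ⊗ c) 0     ≡⟨ ⊗-zeroth (a ⊗ b) c ⟩
    (a ⊗ b) 0 * c 0     ≡⟨ cong (_* c 0) (⊗-zeroth a b) ⟩
    a 0 * b 0 * c 0     ≡⟨ ℤ.*-assoc (a 0) (b 0) (c 0) ⟩
    a 0 * (b 0 * c 0)   ≡⟨ cong (a 0 *_) (⊗-zeroth b c) ⟨
    a 0 * (b ⊗ c) 0     ≡⟨ ⊗-zeroth a (b ⊗ c) ⟨
    (a ⊗ (b ⊗ c)) 0     ∎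
    where open ≡-Reasoning
  ⊗-assoc a b c (suc n) = begin
    ((a ⊗ b) ⊗ c) (suc n)
      ≡⟨ ⊗-suc (a ⊗ b) c n ⟩
    (a ⊗ b) 0 * c (suc n) + (tail (a ⊗ b) ⊗ c) n
      ≡⟨ cong₂ _+_ (cong (_* c (suc n)) (⊗-zeroth a b)) (⊗-cong {b = c} (⊗-suc a b) (λ _ → refl) n) ⟩
    a 0 * b 0 * c (suc n) + ((scale (a 0) (tail b) ⊕ tail a ⊗ b) ⊗ c) n
      ≡⟨ cong (λ t → a 0 * b 0 * c (suc n) + t) (⊗-distribʳ (scale (a 0) (tail b)) (tail a ⊗ b) c n) ⟩
    a 0 * b 0 * c (suc n) + ((scale (a 0) (tail b) ⊗ c) n + ((tail a ⊗ b) ⊗ c) n)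
      ≡⟨ cong (λ t → a 0 * b 0 * c (suc n) + t) (cong₂ _+_ (scale-⊗ (a 0) (tail b) c n) (⊗-assoc (tail a) b c n)) ⟩
    a 0 * b 0 * c (suc n) + (a 0 * (tail b ⊗ c) n + (tail a ⊗ (b ⊗ c)) n)
      ≡⟨ factor (a 0) (b 0) (c (suc n)) _ _ ⟩
    a 0 * (b 0 * c (suc n) + (tail b ⊗ c) n) + (tail a ⊗ (b ⊗ c)) n
      ≡⟨ cong (λ t → a 0 * t + (tail a ⊗ (b ⊗ c)) n) (⊗-suc b c n) ⟨
    a 0 * (b ⊗ c) (suc n) + (tail a ⊗ (b ⊗ c)) n
      ≡⟨ ⊗-suc a (b ⊗ c) n ⟨
    (a ⊗ (b ⊗ c)) (suc n)
      ∎
    where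
    open ≡-Reasoning
    factor : ∀ x y z u v → x * y * z + (x * u + v) ≡ x * (y * z + u) + v
    factor = solve-∀

  Z⊗-zeroth : ∀ a → (Z ⊗ a) 0 ≡ + 0
  Z⊗-zeroth a = ⊗-zeroth Z a

  Z⊗-suc : ∀ a n → (Z ⊗ a) (suc n) ≡ a n
  Z⊗-suc a n = begin
    (Z ⊗ a) (suc n)                   ≡⟨ ⊗-suc Z a n ⟩
    + 0 * a (suc n) + (tail Z ⊗ a) n  ≡⟨ ℤ.+-identityˡ _ ⟩
    (tail Z ⊗ a) n                    ≡⟨ ⊗-cong {b = a} tail-Z (λ _ → refl) n ⟩
    (one ⊗ a) n                       ≡⟨ ⊗-identityˡ a n ⟩
    a n                               ∎
    where
    open ≡-Reasoning
    tail-Z : tail Z ≗ one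
    tail-Z zero    = refl
    tail-Z (suc n) = refl

  shift : ℕ → Series → Series
  shift k a i = a (k ℕ.+ i)

  dotFrom : Series → ℕ → List ℤ → ℤ
  dotFrom a k []       = + 0
  dotFrom a k (x ∷ xs) = a k * x + dotFrom a (suc k) xs

  dotFrom-unique : ∀ a (dot : ℕ → List ℤ → ℤ) →
                   (∀ k → dot k [] ≡ + 0) → (∀ k x xs → dot k (x ∷ xs) ≡ a k * x + dot (suc k) xs) →
                   ∀ k xs → dot k xs ≡ dotFrom a k xs
  dotFrom-unique a dot dot-[] dot-∷ k []       = dot-[] k
  dotFrom-unique a dot dot-[] dot-∷ k (x ∷ xs) =
    trans (dot-∷ k x xs) (cong (λ t → a k * x + t) (dotFrom-unique a dot dot-[] dot-∷ (suc k) xs))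

  -- The helper `dot` local to `invRev` cannot be named; abstracting its arguments lets
  -- unification find it, and `dotFrom-unique` identifies it by its defining equations.
  inv-suc : ∀ a n → inv a (suc n) ≡ - (a 0 * dotFrom a 1 (invRev a n))
  inv-suc a n = abstracted
    where
    dot : ℕ → List ℤ → ℤ
    dot = _
    abstracted : inv a (suc n) ≡ - (a 0 * dotFrom a 1 (invRev a n))
    abstracted with 1 | invRev a n
    ... | k | ys = cong (λ t → - (a 0 * t)) (dotFrom-unique a dot (λ _ → refl) (λ _ _ _ → refl) k ys)

  dotFrom-invRev : ∀ a k n → dotFrom a k (invRev a n) ≡ (shift k a ⊗ inv a) n
  dotFrom-invRev a k zero = begin
    a k * a 0 + + 0              ≡⟨ ℤ.+-identityʳ (a k * a 0) ⟩
    a k * a 0                    ≡⟨ cong (λ i → a i * a 0) (ℕₚ.+-identityʳ k) ⟨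
    shift k a 0 * inv a 0        ≡⟨ ⊗-zeroth (shift k a) (inv a) ⟨
    (shift k a ⊗ inv a) 0        ∎
    where open ≡-Reasoning
  dotFrom-invRev a k (suc n) = begin
    a k * inv a (suc n) + dotFrom a (suc k) (invRev a n)
      ≡⟨ cong (λ t → a k * inv a (suc n) + t) (dotFrom-invRev a (suc k) n) ⟩
    a k * inv a (suc n) + (shift (suc k) a ⊗ inv a) n
      ≡⟨ cong₂ (λ m t → a m * inv a (suc n) + t) (ℕₚ.+-identityʳ k)
               (⊗-cong {b = inv a} (λ i → cong a (ℕₚ.+-suc k i)) (λ _ → refl) n) ⟨
    shift k a 0 * inv a (suc n) + (tail (shift k a) ⊗ inv a) n
      ≡⟨ ⊗-suc (shift k a) (inv a) n ⟨
    (shift k a ⊗ inv a) (suc n)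
      ∎
    where open ≡-Reasoning

  ⊗-inverse : ∀ a → a 0 ≡ + 1 → a ⊗ inv a ≗ one
  ⊗-inverse a a₀≡1 zero = trans (⊗-zeroth a (inv a)) (cong (λ t → t * t) a₀≡1)
  ⊗-inverse a a₀≡1 (suc n) = begin
    (a ⊗ inv a) (suc n)
      ≡⟨ ⊗-suc a (inv a) n ⟩
    a 0 * inv a (suc n) + (tail a ⊗ inv a) n
      ≡⟨ cong (λ t → a 0 * t + (tail a ⊗ inv a) n) (inv-suc a n) ⟩
    a 0 * - (a 0 * dotFrom a 1 (invRev a n)) + (tail a ⊗ inv a) n
      ≡⟨ cong₂ (λ c t → c * - (c * t) + (tail a ⊗ inv a) n) a₀≡1 (dotFrom-invRev a 1 n) ⟩
    + 1 * - (+ 1 * (tail a ⊗ inv a) n) + (tail a ⊗ inv a) n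
      ≡⟨ cancel ((tail a ⊗ inv a) n) ⟩
    + 0
      ∎
    where
    open ≡-Reasoning
    cancel : ∀ x → + 1 * - (+ 1 * x) + x ≡ + 0
    cancel = solve-∀

  infix 4 _≈_
  record _≈_ (a b : Series) : Set where
    constructor coefficientwise
    field coeff : a ≗ b
  open _≈_ public

  seriesRing : CommutativeRing 0ℓ 0ℓ
  seriesRing = record
    { Carrier = Series ; _≈_ = _≈_ ; _+_ = _⊕_ ; _*_ = _⊗_ ; -_ = neg ; 0# = zeroˢ ; 1# = one
    ; isCommutativeRing = record
      { isRing = record
        { +-isAbelianGroup = record
          { isGroup = record
            { isMonoid = record
              { isSemigroup = record
                { isMagma = record
                  { isEquivalence = record
                    { refl  = coefficientwise (λ _ → refl)
                    ; sym   = λ p → coefficientwise (λ n → sym (coeff p n))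
                    ; trans = λ p q → coefficientwise (λ n → trans (coeff p n) (coeff q n)) }
                  ; ∙-cong = λ p q → coefficientwise (λ n → cong₂ _+_ (coeff p n) (coeff q n)) }
                ; assoc = λ a b c → coefficientwise (λ n → ℤ.+-assoc (a n) (b n) (c n)) }
              ; identity = (λ a → coefficientwise (λ n → ℤ.+-identityˡ (a n)))
                         , (λ a → coefficientwise (λ n → ℤ.+-identityʳ (a n))) }
            ; inverse = (λ a → coefficientwise (λ n → ℤ.+-inverseˡ (a n)))
                      , (λ a → coefficientwise (λ n → ℤ.+-inverseʳ (a n)))
            ; ⁻¹-cong = λ p → coefficientwise (λ n → cong -_ (coeff p n)) }
          ; comm = λ a b → coefficientwise (λ n → ℤ.+-comm (a n) (b n)) }
        ; *-cong = λ p q → coefficientwise (⊗-cong (coeff p) (coeff q))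
        ; *-assoc = λ a b c → coefficientwise (⊗-assoc a b c)
        ; *-identity = (λ a → coefficientwise (⊗-identityˡ a))
                     , (λ a → coefficientwise (λ n → trans (⊗-comm a one n) (⊗-identityˡ a n)))
        ; distrib = (λ a b c → coefficientwise (λ n → trans (⊗-comm a (b ⊕ c) n) (trans (⊗-distribʳ b c a n)
                                                       (cong₂ _+_ (⊗-comm b a n) (⊗-comm c a n)))))
                  , (λ c a b → coefficientwise (⊗-distribʳ a b c)) }
      ; *-comm = λ a b → coefficientwise (⊗-comm a b) } }

  -- `_⊗_` and `_⊕_` unfold under unification, so the fixed operand of a congruence must be given.
  ⊗-congˡ : ∀ a {b b′} → b ≈ b′ → a ⊗ b ≈ a ⊗ b′
  ⊗-congˡ a b≈b′ = coefficientwise (⊗-cong {a = a} (λ _ → refl) (coeff b≈b′))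

  ⊗-congʳ : ∀ b {a a′} → a ≈ a′ → a ⊗ b ≈ a′ ⊗ b
  ⊗-congʳ b a≈a′ = coefficientwise (⊗-cong {b = b} (coeff a≈a′) (λ _ → refl))

  ⊕-congˡ : ∀ a {b b′} → b ≈ b′ → a ⊕ b ≈ a ⊕ b′
  ⊕-congˡ a b≈b′ = coefficientwise (λ n → cong (λ t → a n + t) (coeff b≈b′ n))

  coeff-Z⊗-zeroth : ∀ {a} b → a ≈ Z ⊗ b → a 0 ≡ + 0
  coeff-Z⊗-zeroth b a≈Zb = trans (coeff a≈Zb 0) (Z⊗-zeroth b)

  coeff-Z⊗-suc : ∀ {a} b → a ≈ Z ⊗ b → ∀ n → a (suc n) ≡ b n
  coeff-Z⊗-suc b a≈Zb n = trans (coeff a≈Zb (suc n)) (Z⊗-suc b n)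

  Z⊗-fromCoefficients : ∀ {a} b → a 0 ≡ + 0 → (∀ n → a (suc n) ≡ b n) → a ≈ Z ⊗ b
  Z⊗-fromCoefficients b a₀ aₛ = coefficientwise λ
    { zero    → trans a₀ (sym (Z⊗-zeroth b))
    ; (suc n) → trans (aₛ n) (sym (Z⊗-suc b n)) }

  constantSeries : ℤ → Series
  constantSeries k zero    = k
  constantSeries k (suc n) = + 0

  -- `constant (+ 1)` has to reduce to `one`, because the solver's `con (+ 1)` denotes it.
  constant : ℤ → Series
  constant (+ 1) = one
  constant k     = constantSeries k

  constant≗ : ∀ k → constant k ≗ constantSeries k
  constant≗ (+ 1)           zero    = refl
  constant≗ (+ 1)           (suc n) = refl
  constant≗ (+ 0)           n       = refl
  constant≗ (+ suc (suc m)) n       = refl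
  constant≗ -[1+ m ]        n       = refl

  constantSeries-* : ∀ k l → constantSeries (k * l) ≗ constantSeries k ⊗ constantSeries l
  constantSeries-* k l zero    = sym (⊗-zeroth (constantSeries k) (constantSeries l))
  constantSeries-* k l (suc n) = sym (begin
    (constantSeries k ⊗ constantSeries l) (suc n)  ≡⟨ ⊗-suc (constantSeries k) (constantSeries l) n ⟩
    k * + 0 + (zeroˢ ⊗ constantSeries l) n         ≡⟨ cong₂ _+_ (ℤ.*-zeroʳ k) (⊗-zeroˡ (constantSeries l) n) ⟩
    + 0                                            ∎)
    where open ≡-Reasoning

  constantSeries-+ : ∀ k l → constantSeries (k + l) ≗ constantSeries k ⊕ constantSeries l
  constantSeries-+ k l zero    = refl
  constantSeries-+ k l (suc n) = refl

  constantSeries-neg : ∀ k → constantSeries (- k) ≗ neg (constantSeries k)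
  constantSeries-neg k zero    = refl
  constantSeries-neg k (suc n) = refl

  constantHomomorphism : CommutativeRing.rawRing ℤ.+-*-commutativeRing
                           ACR.-Raw-AlmostCommutative⟶ ACR.fromCommutativeRing seriesRing
  constantHomomorphism = record
    { ⟦_⟧    = constant
    ; +-homo = λ k l → coefficientwise λ n → trans (constant≗ (k + l) n)
        (trans (constantSeries-+ k l n) (sym (cong₂ _+_ (constant≗ k n) (constant≗ l n))))
    ; *-homo = λ k l → coefficientwise λ n → trans (constant≗ (k * l) n)
        (trans (constantSeries-* k l n) (sym (⊗-cong (constant≗ k) (constant≗ l) n)))
    ; -‿homo = λ k → coefficientwise λ n → trans (constant≗ (- k) n)
        (trans (constantSeries-neg k n) (sym (cong -_ (constant≗ k n))))
    ; 0-homo = coefficientwise λ { zero → refl ; (suc n) → refl }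
    ; 1-homo = coefficientwise λ _ → refl }

  constant-≟ : ∀ k l → Maybe (constant k ≈ constant l)
  constant-≟ k l with k ℤ.≟ l
  ... | yes refl = just (coefficientwise (λ _ → refl))
  ... | no _     = nothing

  open RingSolver _ _ constantHomomorphism constant-≟ using (solve; _:=_; _:+_; _:*_; _:-_; _:^_; con) public

module RecurrenceSystem where

  open FormalPowerSeries
  open import Data.Integer using (_+_; _*_; _-_)
  open import Algebra.Bundles using (CommutativeRing)
  import Algebra.Properties.Group as GroupProperties
  import Relation.Binary.Reasoning.Setoid as SetoidReasoning

  open CommutativeRing seriesRing
    using (setoid; +-cong; +-congʳ; *-cong; *-assoc; *-identityʳ; zeroʳ; -‿cong)
    renaming (refl to ≈-refl; sym to ≈-sym; trans to ≈-trans)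
  open GroupProperties (CommutativeRing.+-group seriesRing) using (x∙y⁻¹≈ε⇒x≈y)
  module ≈-Reasoning = SetoidReasoning setoid

  record Recurrences (F G H : ℕ → Series) : Set where
    field
      F-zero : F 0 ≈ one
      F-suc  : ∀ j → F (suc j) ≈ Z ⊗ (F j ⊕ G j)
      G-eq   : ∀ j → G j ≈ Z ⊗ (F (suc j) ⊕ H (suc j))
      H-eq   : ∀ j → H j ≈ Z ⊗ G (suc j)

    F-suc-zeroth : ∀ j → F (suc j) 0 ≡ + 0
    F-suc-zeroth j = coeff-Z⊗-zeroth (F j ⊕ G j) (F-suc j)

    G-zeroth : ∀ j → G j 0 ≡ + 0
    G-zeroth j = coeff-Z⊗-zeroth (F (suc j) ⊕ H (suc j)) (G-eq j)

    H-zeroth : ∀ j → H j 0 ≡ + 0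
    H-zeroth j = coeff-Z⊗-zeroth (G (suc j)) (H-eq j)

    F-suc-coeff : ∀ j n → F (suc j) (suc n) ≡ F j n + G j n
    F-suc-coeff j = coeff-Z⊗-suc (F j ⊕ G j) (F-suc j)

    G-coeff : ∀ j n → G j (suc n) ≡ F (suc j) n + H (suc j) n
    G-coeff j = coeff-Z⊗-suc (F (suc j) ⊕ H (suc j)) (G-eq j)

    H-coeff : ∀ j n → H j (suc n) ≡ G (suc j) n
    H-coeff j = coeff-Z⊗-suc (G (suc j)) (H-eq j)

  module _ {F G H F′ G′ H′ : ℕ → Series} (r : Recurrences F G H) (r′ : Recurrences F′ G′ H′) where
    private
      module R  = Recurrences r
      module R′ = Recurrences r′

    F-unique : ∀ n j → F j n ≡ F′ j n
    G-unique : ∀ n j → G j n ≡ G′ j n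
    H-unique : ∀ n j → H j n ≡ H′ j n

    F-unique n       zero    = trans (coeff R.F-zero n) (sym (coeff R′.F-zero n))
    F-unique zero    (suc j) = trans (R.F-suc-zeroth j) (sym (R′.F-suc-zeroth j))
    F-unique (suc n) (suc j) =
      trans (R.F-suc-coeff j n) (trans (cong₂ _+_ (F-unique n j) (G-unique n j)) (sym (R′.F-suc-coeff j n)))

    G-unique zero    j = trans (R.G-zeroth j) (sym (R′.G-zeroth j))
    G-unique (suc n) j =
      trans (R.G-coeff j n) (trans (cong₂ _+_ (F-unique n (suc j)) (H-unique n (suc j))) (sym (R′.G-coeff j n)))

    H-unique zero    j = trans (R.H-zeroth j) (sym (R′.H-zeroth j))
    H-unique (suc n) j = trans (R.H-coeff j n) (trans (G-unique n (suc j)) (sym (R′.H-coeff j n)))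

  geometric-Recurrences : ∀ (F : ℕ → Series) (p c d : Series) →
    F 0 ≈ one → (∀ j → F (suc j) ≈ p ⊗ F j) →
    p ≈ Z ⊗ (one ⊕ c ⊗ p) → c ≈ Z ⊗ (one ⊕ d ⊗ p) → d ≈ Z ⊗ (c ⊗ p) →
    Recurrences F (λ j → c ⊗ F (suc j)) (λ j → d ⊗ F (suc j))
  geometric-Recurrences F p c d F-zero F-suc p≈ c≈ d≈ = record
    { F-zero = F-zero
    ; F-suc  = λ j → begin
        F (suc j)                       ≈⟨ F-suc j ⟩
        p ⊗ F j                         ≈⟨ ⊗-congʳ (F j) p≈ ⟩
        Z ⊗ (one ⊕ c ⊗ p) ⊗ F j         ≈⟨ expand c (F j) ⟩
        Z ⊗ (F j ⊕ c ⊗ (p ⊗ F j))       ≈⟨ ⊗-congˡ Z (⊕-congˡ (F j) (⊗-congˡ c (F-suc j))) ⟨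
        Z ⊗ (F j ⊕ c ⊗ F (suc j))       ∎
    ; G-eq   = λ j → begin
        c ⊗ F (suc j)                             ≈⟨ ⊗-congʳ (F (suc j)) c≈ ⟩
        Z ⊗ (one ⊕ d ⊗ p) ⊗ F (suc j)             ≈⟨ expand d (F (suc j)) ⟩
        Z ⊗ (F (suc j) ⊕ d ⊗ (p ⊗ F (suc j)))     ≈⟨ ⊗-congˡ Z (⊕-congˡ (F (suc j)) (⊗-congˡ d (F-suc (suc j)))) ⟨
        Z ⊗ (F (suc j) ⊕ d ⊗ F (suc (suc j)))     ∎
    ; H-eq   = λ j → begin
        d ⊗ F (suc j)                 ≈⟨ ⊗-congʳ (F (suc j)) d≈ ⟩
        Z ⊗ (c ⊗ p) ⊗ F (suc j)       ≈⟨ *-assoc Z (c ⊗ p) (F (suc j)) ⟩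
        Z ⊗ (c ⊗ p ⊗ F (suc j))       ≈⟨ ⊗-congˡ Z (*-assoc c p (F (suc j))) ⟩
        Z ⊗ (c ⊗ (p ⊗ F (suc j)))     ≈⟨ ⊗-congˡ Z (⊗-congˡ c (F-suc (suc j))) ⟨
        Z ⊗ (c ⊗ F (suc (suc j)))     ∎
    }
    where
    open ≈-Reasoning
    expand : ∀ k x → Z ⊗ (one ⊕ k ⊗ p) ⊗ x ≈ Z ⊗ (x ⊕ k ⊗ (p ⊗ x))
    expand k x = solve 4 (λ z k p x → z :* (con (+ 1) :+ k :* p) :* x := z :* (x :+ k :* (p :* x)))
                         ≈-refl Z k p x

  -- p = z w⁻¹ is v₁⁻¹, and G0-eq, H0-eq, p-eq are g₀ = z (1 + h₀) v₁⁻¹, h₀ = z g₀ v₁⁻¹, v₁⁻¹ = z (1 + g₀).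
  module RootSolution (w : Series) (w₀≡1 : w 0 ≡ + 1) (root : IsRootW w) where
    open ≈-Reasoning

    D i e p : Series
    D = w ^ˢ 2 ⊖ Z ^ˢ 4
    i = inv w
    e = inv D
    p = Z ⊗ i

    w⊗i≈1 : w ⊗ i ≈ one
    w⊗i≈1 = coefficientwise (⊗-inverse w w₀≡1)

    D⊗e≈1 : D ⊗ e ≈ one
    D⊗e≈1 = coefficientwise (⊗-inverse D D₀≡1)
      where
      w²₀≡1 : (w ^ˢ 2) 0 ≡ + 1
      w²₀≡1 = trans (⊗-zeroth w (w ⊗ one))
                    (cong₂ _*_ w₀≡1 (trans (⊗-zeroth w one) (cong (_* + 1) w₀≡1)))
      D₀≡1 : D 0 ≡ + 1
      D₀≡1 = cong₂ _-_ w²₀≡1 (Z⊗-zeroth (Z ^ˢ 3))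

    one⊕H0≈w²e : one ⊕ H0 w ≈ w ^ˢ 2 ⊗ e
    one⊕H0≈w²e = begin
      one ⊕ Z ^ˢ 4 ⊗ e        ≈⟨ +-congʳ D⊗e≈1 ⟨
      D ⊗ e ⊕ Z ^ˢ 4 ⊗ e      ≈⟨ solve 3 (λ w z e → (w :^ 2 :- z :^ 4) :* e :+ z :^ 4 :* e := w :^ 2 :* e)
                                         ≈-refl w Z e ⟩
      w ^ˢ 2 ⊗ e              ∎

    G0-eq : Z ⊗ (one ⊕ H0 w) ⊗ p ≈ G0 w
    G0-eq = begin
      Z ⊗ (one ⊕ H0 w) ⊗ (Z ⊗ i)  ≈⟨ ⊗-congʳ p (⊗-congˡ Z one⊕H0≈w²e) ⟩
      Z ⊗ (w ^ˢ 2 ⊗ e) ⊗ (Z ⊗ i)  ≈⟨ solve 4 (λ z w e i → z :* (w :^ 2 :* e) :* (z :* i)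
                                                        := z :^ 2 :* w :* e :* (w :* i))
                                             ≈-refl Z w e i ⟩
      G0 w ⊗ (w ⊗ i)              ≈⟨ ⊗-congˡ (G0 w) w⊗i≈1 ⟩
      G0 w ⊗ one                  ≈⟨ *-identityʳ (G0 w) ⟩
      G0 w                        ∎

    H0-eq : Z ⊗ G0 w ⊗ p ≈ H0 w
    H0-eq = begin
      Z ⊗ (Z ^ˢ 2 ⊗ w ⊗ e) ⊗ (Z ⊗ i)  ≈⟨ solve 4 (λ z w e i → z :* (z :^ 2 :* w :* e) :* (z :* i)
                                                            := z :^ 4 :* e :* (w :* i))
                                                 ≈-refl Z w e i ⟩
      H0 w ⊗ (w ⊗ i)                  ≈⟨ ⊗-congˡ (H0 w) w⊗i≈1 ⟩
      H0 w ⊗ one                      ≈⟨ *-identityʳ (H0 w) ⟩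
      H0 w                            ∎

    -- the root equation, divided by w (w² − z⁴)
    p-eq : Z ⊗ (one ⊕ G0 w) ≈ p
    p-eq = x∙y⁻¹≈ε⇒x≈y _ _ (begin
      Z ⊗ (one ⊕ Z ^ˢ 2 ⊗ w ⊗ e) ⊖ Z ⊗ i
        ≈⟨ solve 4 (λ z w e i → z :* (con (+ 1) :+ z :^ 2 :* w :* e) :- z :* i
                             := z :* con (+ 1) :* con (+ 1) :+ z :^ 3 :* w :* e :* con (+ 1)
                                :- z :* i :* con (+ 1))
                   ≈-refl Z w e i ⟩
      Z ⊗ one ⊗ one ⊕ Z ^ˢ 3 ⊗ w ⊗ e ⊗ one ⊖ Z ⊗ i ⊗ one
        ≈⟨ +-cong (+-cong (*-cong (⊗-congˡ Z w⊗i≈1) D⊗e≈1) (⊗-congˡ (Z ^ˢ 3 ⊗ w ⊗ e) w⊗i≈1))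
                  (-‿cong (⊗-congˡ (Z ⊗ i) D⊗e≈1)) ⟨
      Z ⊗ (w ⊗ i) ⊗ (D ⊗ e) ⊕ Z ^ˢ 3 ⊗ w ⊗ e ⊗ (w ⊗ i) ⊖ Z ⊗ i ⊗ (D ⊗ e)
        ≈⟨ solve 4 (λ z w e i → z :* (w :* i) :* ((w :^ 2 :- z :^ 4) :* e) :+ z :^ 3 :* w :* e :* (w :* i)
                                :- z :* i :* ((w :^ 2 :- z :^ 4) :* e)
                             := i :* e :* (z :* w :^ 3 :+ (z :^ 2 :- con (+ 1)) :* z :* w :^ 2
                                           :- z :^ 5 :* w :+ z :^ 5))
                   ≈-refl Z w e i ⟩
      i ⊗ e ⊗ (Z ⊗ w ^ˢ 3 ⊕ (Z ^ˢ 2 ⊖ one) ⊗ Z ⊗ w ^ˢ 2 ⊖ Z ^ˢ 5 ⊗ w ⊕ Z ^ˢ 5)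
        ≈⟨ ⊗-congˡ (i ⊗ e) (coefficientwise root) ⟩
      i ⊗ e ⊗ zeroˢ
        ≈⟨ zeroʳ (i ⊗ e) ⟩
      zeroˢ
        ∎)

    vInvPow-suc : ∀ j → vInvPow w (suc j) ≈ p ⊗ vInvPow w j
    vInvPow-suc j = solve 4 (λ z zʲ i iʲ → z :* zʲ :* (i :* iʲ) := z :* i :* (zʲ :* iʲ))
                            ≈-refl Z (Z ^ˢ j) i (i ^ˢ j)

    rootRecurrences : Recurrences (vInvPow w) (λ j → Z ⊗ (one ⊕ H0 w) ⊗ vInvPow w (suc j))
                                              (λ j → Z ⊗ G0 w ⊗ vInvPow w (suc j))
    rootRecurrences = geometric-Recurrences (vInvPow w) p (Z ⊗ (one ⊕ H0 w)) (Z ⊗ G0 w)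
      (coefficientwise (⊗-identityˡ one)) vInvPow-suc
      (≈-trans (≈-sym p-eq) (⊗-congˡ Z (⊕-congˡ one (≈-sym G0-eq))))
      (⊗-congˡ Z (⊕-congˡ one (≈-sym H0-eq)))
      (⊗-congˡ Z (≈-sym G0-eq))

module PathCounting where

  open FormalPowerSeries using (coefficientwise; Z⊗-fromCoefficients)
  open RecurrenceSystem using (Recurrences)
  open import Data.Bool using (Bool; true; false; not; _∧_)
  open import Data.Bool.Properties using (∧-zeroʳ; ∧-identityʳ; ∧-assoc)
  open import Data.Nat using (_+_)
  import Data.Nat.Properties as ℕₚ
  open import Data.List using (List; []; _∷_; _++_; _∷ʳ_; map)
  open import Data.List.Properties using (++-identityʳ)
  open import Data.List.Reverse using (reverseView; []; _∶_∶ʳ_)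
  open import Data.Maybe using (just; nothing)
  import Data.Maybe as Maybe
  open import Algebra.Properties.CommutativeSemigroup ℕₚ.+-commutativeSemigroup using (interchange)

  indicator : Bool → ℕ
  indicator true  = 1
  indicator false = 0

  countᵇ-∷ : ∀ {A : Set} (P : A → Bool) x xs → countᵇ P (x ∷ xs) ≡ indicator (P x) + countᵇ P xs
  countᵇ-∷ P x xs with P x
  ... | true  = refl
  ... | false = refl

  countᵇ-++ : ∀ {A : Set} (P : A → Bool) xs ys → countᵇ P (xs ++ ys) ≡ countᵇ P xs + countᵇ P ys
  countᵇ-++ P []       ys = refl
  countᵇ-++ P (x ∷ xs) ys = begin
    countᵇ P (x ∷ xs ++ ys)                        ≡⟨ countᵇ-∷ P x (xs ++ ys) ⟩
    indicator (P x) + countᵇ P (xs ++ ys)          ≡⟨ cong (λ t → indicator (P x) + t) (countᵇ-++ P xs ys) ⟩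
    indicator (P x) + (countᵇ P xs + countᵇ P ys)  ≡⟨ ℕₚ.+-assoc (indicator (P x)) _ _ ⟨
    indicator (P x) + countᵇ P xs + countᵇ P ys    ≡⟨ cong (_+ countᵇ P ys) (countᵇ-∷ P x xs) ⟨
    countᵇ P (x ∷ xs) + countᵇ P ys                ∎
    where open ≡-Reasoning

  countᵇ-map : ∀ {A B : Set} (P : B → Bool) (φ : A → B) xs → countᵇ P (map φ xs) ≡ countᵇ (λ x → P (φ x)) xs
  countᵇ-map P φ []       = refl
  countᵇ-map P φ (x ∷ xs) = trans (countᵇ-∷ P (φ x) (map φ xs))
    (trans (cong (λ t → indicator (P (φ x)) + t) (countᵇ-map P φ xs)) (sym (countᵇ-∷ (λ x → P (φ x)) x xs)))

  countᵇ-+ : ∀ {A : Set} {P P′ Q R : A → Bool} →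
    (∀ x → indicator (P x) + indicator (P′ x) ≡ indicator (Q x) + indicator (R x)) →
    ∀ xs → countᵇ P xs + countᵇ P′ xs ≡ countᵇ Q xs + countᵇ R xs
  countᵇ-+ eq [] = refl
  countᵇ-+ {P = P} {P′} {Q} {R} eq (x ∷ xs) = begin
    countᵇ P (x ∷ xs) + countᵇ P′ (x ∷ xs)
      ≡⟨ cong₂ _+_ (countᵇ-∷ P x xs) (countᵇ-∷ P′ x xs) ⟩
    (indicator (P x) + countᵇ P xs) + (indicator (P′ x) + countᵇ P′ xs)
      ≡⟨ interchange (indicator (P x)) _ _ _ ⟩
    (indicator (P x) + indicator (P′ x)) + (countᵇ P xs + countᵇ P′ xs)
      ≡⟨ cong₂ _+_ (eq x) (countᵇ-+ eq xs) ⟩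
    (indicator (Q x) + indicator (R x)) + (countᵇ Q xs + countᵇ R xs)
      ≡⟨ interchange (indicator (Q x)) _ _ _ ⟩
    (indicator (Q x) + countᵇ Q xs) + (indicator (R x) + countᵇ R xs)
      ≡⟨ cong₂ _+_ (countᵇ-∷ Q x xs) (countᵇ-∷ R x xs) ⟨
    countᵇ Q (x ∷ xs) + countᵇ R (x ∷ xs)
      ∎
    where open ≡-Reasoning

  countᵇ-false : ∀ {A : Set} (xs : List A) → countᵇ (λ _ → false) xs ≡ 0
  countᵇ-false []       = refl
  countᵇ-false (x ∷ xs) = countᵇ-false xs

  Count : (List Bool → Bool) → ℕ → ℕ
  Count P n = countᵇ P (allPaths n)

  Count-∷ : ∀ P n → Count P (suc n) ≡ Count (λ q → P (true ∷ q)) n + Count (λ q → P (false ∷ q)) n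
  Count-∷ P n = trans (countᵇ-++ P (map (true ∷_) (allPaths n)) (map (false ∷_) (allPaths n)))
                      (cong₂ _+_ (countᵇ-map P (true ∷_) (allPaths n)) (countᵇ-map P (false ∷_) (allPaths n)))

  Count-∷ʳ : ∀ P n → Count P (suc n) ≡ Count (λ q → P (q ∷ʳ true)) n + Count (λ q → P (q ∷ʳ false)) n
  Count-∷ʳ P zero    = Count-∷ P 0
  Count-∷ʳ P (suc n) = begin
    Count P (suc (suc n))
      ≡⟨ Count-∷ P (suc n) ⟩
    Count (λ q → P (true ∷ q)) (suc n) + Count (λ q → P (false ∷ q)) (suc n)
      ≡⟨ cong₂ _+_ (Count-∷ʳ (λ q → P (true ∷ q)) n) (Count-∷ʳ (λ q → P (false ∷ q)) n) ⟩
    (Count (λ q → P (true ∷ q ∷ʳ true)) n + Count (λ q → P (true ∷ q ∷ʳ false)) n) +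
    (Count (λ q → P (false ∷ q ∷ʳ true)) n + Count (λ q → P (false ∷ q ∷ʳ false)) n)
      ≡⟨ interchange (Count (λ q → P (true ∷ q ∷ʳ true)) n) _ _ _ ⟩
    (Count (λ q → P (true ∷ q ∷ʳ true)) n + Count (λ q → P (false ∷ q ∷ʳ true)) n) +
    (Count (λ q → P (true ∷ q ∷ʳ false)) n + Count (λ q → P (false ∷ q ∷ʳ false)) n)
      ≡⟨ cong₂ _+_ (Count-∷ (λ q → P (q ∷ʳ true)) n) (Count-∷ (λ q → P (q ∷ʳ false)) n) ⟨
    Count (λ q → P (q ∷ʳ true)) (suc n) + Count (λ q → P (q ∷ʳ false)) (suc n)
      ∎
    where open ≡-Reasoning

  Count-last-step : ∀ {P Q R : List Bool → Bool} →
    (∀ q → indicator (P (q ∷ʳ true)) + indicator (P (q ∷ʳ false)) ≡ indicator (Q q) + indicator (R q)) →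
    ∀ n → Count P (suc n) ≡ Count Q n + Count R n
  Count-last-step {P} eq n = trans (Count-∷ʳ P n) (countᵇ-+ eq (allPaths n))

  lastStep-∷ʳ : ∀ p b → lastStep (p ∷ʳ b) ≡ just b
  lastStep-∷ʳ []          b = refl
  lastStep-∷ʳ (s ∷ [])    b = refl
  lastStep-∷ʳ (s ∷ t ∷ p) b = lastStep-∷ʳ (t ∷ p) b

  endsUp-∷ʳ : ∀ p b → endsUp (p ∷ʳ b) ≡ b
  endsUp-∷ʳ p true  rewrite lastStep-∷ʳ p true  = refl
  endsUp-∷ʳ p false rewrite lastStep-∷ʳ p false = refl

  endsDown-∷ʳ : ∀ p b → endsDown (p ∷ʳ b) ≡ not b
  endsDown-∷ʳ p true  rewrite lastStep-∷ʳ p true  = refl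
  endsDown-∷ʳ p false rewrite lastStep-∷ʳ p false = refl

  isEmpty-∷ʳ : ∀ p b → isEmpty (p ∷ʳ b) ≡ false
  isEmpty-∷ʳ []      b = refl
  isEmpty-∷ʳ (s ∷ p) b = refl

  isF-∷ʳ : ∀ j p b → isF j (p ∷ʳ b) ≡ endsAt j (p ∷ʳ b) ∧ b ∧ allOdd (descents (p ∷ʳ b))
  isF-∷ʳ j p b rewrite isEmpty-∷ʳ p b | endsUp-∷ʳ p b = refl

  isG-∷ʳ : ∀ j p b → isG j (p ∷ʳ b) ≡ endsAt j (p ∷ʳ b) ∧ not b ∧ allOdd (descents (p ∷ʳ b))
  isG-∷ʳ j p b rewrite endsDown-∷ʳ p b = refl

  isH-∷ʳ : ∀ j p b → isH j (p ∷ʳ b) ≡ endsAt j (p ∷ʳ b) ∧ not b ∧ lastEvenOthersOdd (descents (p ∷ʳ b))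
  isH-∷ʳ j p b rewrite endsDown-∷ʳ p b = refl

  endHeightFrom-++ : ∀ h p r → endHeightFrom h (p ++ r) ≡ (endHeightFrom h p Maybe.>>= λ h′ → endHeightFrom h′ r)
  endHeightFrom-++ h       []          r = refl
  endHeightFrom-++ h       (true ∷ p)  r = endHeightFrom-++ (suc h) p r
  endHeightFrom-++ zero    (false ∷ p) r = refl
  endHeightFrom-++ (suc h) (false ∷ p) r = endHeightFrom-++ h p r

  endsAt-∷ʳ-up : ∀ j p → endsAt (suc j) (p ∷ʳ true) ≡ endsAt j p
  endsAt-∷ʳ-up j p rewrite endHeightFrom-++ 0 p (true ∷ []) with endHeightFrom 0 p
  ... | nothing = refl
  ... | just h  = refl

  endsAt-zero-∷ʳ-up : ∀ p → endsAt 0 (p ∷ʳ true) ≡ false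
  endsAt-zero-∷ʳ-up p rewrite endHeightFrom-++ 0 p (true ∷ []) with endHeightFrom 0 p
  ... | nothing = refl
  ... | just h  = refl

  endsAt-∷ʳ-down : ∀ j p → endsAt j (p ∷ʳ false) ≡ endsAt (suc j) p
  endsAt-∷ʳ-down j p rewrite endHeightFrom-++ 0 p (false ∷ []) with endHeightFrom 0 p
  ... | nothing      = refl
  ... | just zero    = refl
  ... | just (suc h) = refl

  -- Reading a path with a descent of length k in progress: `closedRuns` are the descents
  -- completed so far, `currentRun` the length of the one in progress (0 if none).
  closedRuns : ℕ → List Bool → List ℕ
  closedRuns k       []          = []
  closedRuns zero    (true ∷ p)  = closedRuns 0 p
  closedRuns (suc k) (true ∷ p)  = suc k ∷ closedRuns 0 p
  closedRuns k       (false ∷ p) = closedRuns (suc k) p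

  currentRun : ℕ → List Bool → ℕ
  currentRun k []          = k
  currentRun k (true ∷ p)  = currentRun 0 p
  currentRun k (false ∷ p) = currentRun (suc k) p

  descentsAux-++ : ∀ k p r → descentsAux k (p ++ r) ≡ closedRuns k p ++ descentsAux (currentRun k p) r
  descentsAux-++ k       []          r = refl
  descentsAux-++ zero    (true ∷ p)  r = descentsAux-++ 0 p r
  descentsAux-++ (suc k) (true ∷ p)  r = cong (suc k ∷_) (descentsAux-++ 0 p r)
  descentsAux-++ zero    (false ∷ p) r = descentsAux-++ 1 p r
  descentsAux-++ (suc k) (false ∷ p) r = descentsAux-++ (suc (suc k)) p r

  currentRun-++ : ∀ k p r → currentRun k (p ++ r) ≡ currentRun (currentRun k p) r
  currentRun-++ k []          r = refl
  currentRun-++ k (true ∷ p)  r = currentRun-++ 0 p r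
  currentRun-++ k (false ∷ p) r = currentRun-++ (suc k) p r

  descents-split : ∀ p → descents p ≡ closedRuns 0 p ++ descentsAux (currentRun 0 p) []
  descents-split p = trans (cong descents (sym (++-identityʳ p))) (descentsAux-++ 0 p [])

  descents-∷ʳ-up : ∀ p → descents (p ∷ʳ true) ≡ descents p
  descents-∷ʳ-up p = trans (descentsAux-++ 0 p (true ∷ []))
    (trans (cong (closedRuns 0 p ++_) (closing (currentRun 0 p))) (sym (descents-split p)))
    where
    closing : ∀ k → descentsAux k (true ∷ []) ≡ descentsAux k []
    closing zero    = refl
    closing (suc k) = refl

  descents-∷ʳ-down : ∀ p → descents (p ∷ʳ false) ≡ closedRuns 0 p ∷ʳ suc (currentRun 0 p)
  descents-∷ʳ-down p = trans (descentsAux-++ 0 p (false ∷ [])) (cong (closedRuns 0 p ++_) (extending (currentRun 0 p)))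
    where
    extending : ∀ k → descentsAux k (false ∷ []) ≡ suc k ∷ []
    extending zero    = refl
    extending (suc k) = refl

  allOdd-++ : ∀ xs ys → allOdd (xs ++ ys) ≡ allOdd xs ∧ allOdd ys
  allOdd-++ []       ys = refl
  allOdd-++ (x ∷ xs) ys = trans (cong (odd x ∧_) (allOdd-++ xs ys)) (sym (∧-assoc (odd x) (allOdd xs) (allOdd ys)))

  lastEvenOthersOdd-∷ʳ : ∀ xs y → lastEvenOthersOdd (xs ∷ʳ y) ≡ allOdd xs ∧ even y
  lastEvenOthersOdd-∷ʳ []           y = refl
  lastEvenOthersOdd-∷ʳ (x ∷ [])     y = cong (_∧ even y) (sym (∧-identityʳ (odd x)))
  lastEvenOthersOdd-∷ʳ (x ∷ x′ ∷ xs) y =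
    trans (cong (odd x ∧_) (lastEvenOthersOdd-∷ʳ (x′ ∷ xs) y)) (sym (∧-assoc (odd x) (allOdd (x′ ∷ xs)) (even y)))

  even-suc : ∀ n → even (suc n) ≡ odd n
  even-suc zero          = refl
  even-suc (suc zero)    = refl
  even-suc (suc (suc n)) = even-suc n

  F-zero-last-step : ∀ q → indicator (isF 0 (q ∷ʳ true)) + indicator (isF 0 (q ∷ʳ false))
                           ≡ indicator false + indicator false
  F-zero-last-step q
    rewrite isF-∷ʳ 0 q true | isF-∷ʳ 0 q false | endsAt-zero-∷ʳ-up q | ∧-zeroʳ (endsAt 0 (q ∷ʳ false)) = refl

  indicator-split : ∀ x b y → indicator (x ∧ y) + 0 ≡ indicator (x ∧ b ∧ y) + indicator (x ∧ not b ∧ y)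
  indicator-split false b     y = refl
  indicator-split true  true  y = refl
  indicator-split true  false y = ℕₚ.+-identityʳ (indicator y)

  F-suc-last-step : ∀ j q → indicator (isF (suc j) (q ∷ʳ true)) + indicator (isF (suc j) (q ∷ʳ false))
                            ≡ indicator (isF j q) + indicator (isG j q)
  F-suc-last-step j q
    rewrite isF-∷ʳ (suc j) q true | isF-∷ʳ (suc j) q false | ∧-zeroʳ (endsAt (suc j) (q ∷ʳ false))
          | endsAt-∷ʳ-up j q | descents-∷ʳ-up q
    with reverseView q
  ... | [] with j
  ...   | zero  = refl
  ...   | suc _ = refl
  F-suc-last-step j _ | p ∶ _ ∶ʳ b rewrite isF-∷ʳ j p b | isG-∷ʳ j p b =
    indicator-split (endsAt j (p ∷ʳ b)) b (allOdd (descents (p ∷ʳ b)))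

  -- A down-step lengthens the current descent by one, flipping its parity.
  G-last-step : ∀ j q → indicator (isG j (q ∷ʳ true)) + indicator (isG j (q ∷ʳ false))
                        ≡ indicator (isF (suc j) q) + indicator (isH (suc j) q)
  G-last-step j q
    rewrite isG-∷ʳ j q true | isG-∷ʳ j q false | ∧-zeroʳ (endsAt j (q ∷ʳ true))
          | endsAt-∷ʳ-down j q | descents-∷ʳ-down q | allOdd-++ (closedRuns 0 q) (suc (currentRun 0 q) ∷ [])
    with reverseView q
  ... | [] = refl
  ... | p ∶ _ ∶ʳ true
    rewrite isF-∷ʳ (suc j) p true | isH-∷ʳ (suc j) p true | ∧-zeroʳ (endsAt (suc j) (p ∷ʳ true))
          | descents-split (p ∷ʳ true) | currentRun-++ 0 p (true ∷ []) | ++-identityʳ (closedRuns 0 (p ∷ʳ true))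
          | ∧-identityʳ (allOdd (closedRuns 0 (p ∷ʳ true))) = sym (ℕₚ.+-identityʳ _)
  ... | p ∶ _ ∶ʳ false
    rewrite isF-∷ʳ (suc j) p false | isH-∷ʳ (suc j) p false | ∧-zeroʳ (endsAt (suc j) (p ∷ʳ false))
          | descents-split (p ∷ʳ false) | currentRun-++ 0 p (false ∷ [])
          | lastEvenOthersOdd-∷ʳ (closedRuns 0 (p ∷ʳ false)) (suc (currentRun 0 p)) | even-suc (currentRun 0 p)
          | ∧-identityʳ (odd (currentRun 0 p)) = refl

  H-last-step : ∀ j q → indicator (isH j (q ∷ʳ true)) + indicator (isH j (q ∷ʳ false))
                        ≡ indicator (isG (suc j) q) + indicator false
  H-last-step j q
    rewrite isH-∷ʳ j q true | isH-∷ʳ j q false | ∧-zeroʳ (endsAt j (q ∷ʳ true))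
          | endsAt-∷ʳ-down j q | descents-∷ʳ-down q
          | lastEvenOthersOdd-∷ʳ (closedRuns 0 q) (suc (currentRun 0 q)) | even-suc (currentRun 0 q)
    with reverseView q
  ... | [] = refl
  ... | p ∶ _ ∶ʳ true
    rewrite isG-∷ʳ (suc j) p true | currentRun-++ 0 p (true ∷ [])
          | ∧-zeroʳ (allOdd (closedRuns 0 (p ∷ʳ true))) | ∧-zeroʳ (endsAt (suc j) (p ∷ʳ true)) = refl
  ... | p ∶ _ ∶ʳ false
    rewrite isG-∷ʳ (suc j) p false | descents-split (p ∷ʳ false) | currentRun-++ 0 p (false ∷ [])
          | allOdd-++ (closedRuns 0 (p ∷ʳ false)) (suc (currentRun 0 p) ∷ [])
          | ∧-identityʳ (odd (suc (currentRun 0 p))) = sym (ℕₚ.+-identityʳ _)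

  g-zeroth : ∀ j → g j 0 ≡ + 0
  g-zeroth zero    = refl
  g-zeroth (suc j) = refl

  h-zeroth : ∀ j → h j 0 ≡ + 0
  h-zeroth zero    = refl
  h-zeroth (suc j) = refl

  pathRecurrences : Recurrences f g h
  pathRecurrences = record
    { F-zero = coefficientwise λ
        { zero    → refl
        ; (suc n) → cong +_ (trans (Count-last-step F-zero-last-step n)
                                   (cong₂ _+_ (countᵇ-false (allPaths n)) (countᵇ-false (allPaths n)))) }
    ; F-suc  = λ j → Z⊗-fromCoefficients (f j ⊕ g j) refl
                       (λ n → cong +_ (Count-last-step (F-suc-last-step j) n))
    ; G-eq   = λ j → Z⊗-fromCoefficients (f (suc j) ⊕ h (suc j)) (g-zeroth j)
                       (λ n → cong +_ (Count-last-step (G-last-step j) n))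
    ; H-eq   = λ j → Z⊗-fromCoefficients (g (suc j)) (h-zeroth j)
                       (λ n → cong +_ (trans (Count-last-step (H-last-step j) n)
                                             (trans (cong (λ t → Count (isG (suc j)) n + t) (countᵇ-false (allPaths n)))
                                                    (ℕₚ.+-identityʳ _))))
    }

open FormalPowerSeries using (coeff)
open RecurrenceSystem using (module Recurrences; module RootSolution; F-unique; G-unique; H-unique)
open PathCounting using (pathRecurrences)

mainTheorem4 : (w : Series) → w 0 ≡ + 1 → IsRootW w →
    (∀ n → f 0 n ≡ one n)
    × (∀ j → 1 ≤ j → ∀ n → f j n ≡ vInvPow w j n)
    × (∀ j n → g j n ≡ (Z ⊗ (one ⊕ H0 w) ⊗ vInvPow w (suc j)) n)
    × (∀ j n → h j n ≡ (Z ⊗ G0 w ⊗ vInvPow w (suc j)) n)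
mainTheorem4 w w₀≡1 root =
    coeff (Recurrences.F-zero pathRecurrences)
  , (λ j _ n → F-unique pathRecurrences rootRecurrences n j)
  , (λ j n → G-unique pathRecurrences rootRecurrences n j)
  , (λ j n → H-unique pathRecurrences rootRecurrences n j)
  where open RootSolution w w₀≡1 root using (rootRecurrences)
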